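{- Let $\Omega$ be a finite set with $n=|\Omega|$, and let $G=\langle\rho_0,\dots,\rho_{r-1}\rangle\leq\mathrm{Sym}(\Omega)$, with generating sequence $(\rho_0,\dots,\rho_{r-1})$, be a string group generated by involutions whose permutation representation graph $\mathcal{G}$ has the following shape: for some $i\in\{0,\dots,r-1\}$, $\mathcal{G}$ has exactly one edge $\{u,v\}$ of label $i$, and there is a partition $\Omega=\Omega'\sqcup\Omega''$ with $u\in\Omega'$, $v\in\Omega''$ such that every edge other than $\{u,v\}$ either has both endpoints in $\Omega'$ and label at most $i-1$, or has both endpoints in $\Omega''$ and label at least $i+1$. Then: (1) if $\mathcal{G}$ is connected, $G$ is isomorphic to $S_n$; (2) if $\mathcal{G}$ is disconnected, let $t$ be the number of vertices of the connected component $\mathcal{C}$ of $\mathcal{G}$ containing the edge $\{u,v\}$, and let $H$ be the permutation group induced by $G$ on the set of vertices not in $\mathcal{C}$ (i.e. on the vertices of the connected components containing no $i$-edge); then $G\cong S_t\times H$.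
   Context: A string group generated by involutions (sggi) is a group $G$ together with an ordered sequence $(\rho_0,\dots,\rho_{r-1})$ of involutions generating $G$ such that $(\rho_i\rho_j)^2=1$ whenever $|i-j|\geq 2$. For a permutation group $G=\langle\rho_0,\dots,\rho_{r-1}\rangle$ on a finite set $\Omega$ generated by involutions, its permutation representation graph is the edge-labelled undirected multigraph with vertex set $\Omega$ having an edge of label $i$ between $a$ and $b$ whenever $a\neq b$ and $\rho_i(a)=b$. -}

module Defs where

open import Level using (0ℓ)
open import Data.Nat using (ℕ; _<_; _+_)
open import Data.Fin using (Fin; toℕ)
open import Data.Bool using (Bool; true; false)
open import Data.List using (List; []; _∷_; _++_; reverse)
open import Data.Product using (Σ; ∃; _×_; _,_)
open import Data.Sum using (_⊎_)
open import Relation.Nullary using (¬_)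
open import Relation.Binary.PropositionalEquality using (_≡_; _≢_)
open import Relation.Binary.Construct.Closure.ReflexiveTransitive using (Star)
open import Function.Bundles using (_↔_)
open import Algebra.Bundles.Raw using (RawGroup)
open import Data.Fin.Permutation as P using (Permutation′; _∘ₚ_; flip)
import Algebra.Construct.DirectProduct as DP
import Algebra.Morphism.Structures as MS

IsInvolution : ∀ {n} → (Fin n → Fin n) → Set
IsInvolution {n} f = (∀ x → f (f x) ≡ x) × (∃ λ x → f x ≢ x)

FarApart : ∀ {r} → Fin r → Fin r → Set
FarApart j k = (toℕ j + 2 ≤′ toℕ k) ⊎ (toℕ k + 2 ≤′ toℕ j)
  where
  open import Data.Nat using () renaming (_≤_ to _≤′_)

IsSggi : ∀ {n r} → (Fin r → Fin n → Fin n) → Set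
IsSggi {n} {r} ρ =
  (∀ j → IsInvolution (ρ j)) ×
  (∀ j k → FarApart j k → ∀ x → ρ j (ρ k (ρ j (ρ k x))) ≡ x)

-- The group G = ⟨ρ₀,…,ρ_{r-1}⟩ ≤ Sym(Ω): elements are represented by
-- words in the generators, two words being equal in G iff they act
-- identically on Ω.

module _ {n r : ℕ} (ρ : Fin r → Fin n → Fin n) where

  eval : List (Fin r) → Fin n → Fin n
  eval []      x = x
  eval (j ∷ w) x = ρ j (eval w x)

  -- G as a (raw) group: product = composition (w ∙ w' acts as w ∘ w'),
  -- inverse = reversed word (generators are involutions).
  GroupG : RawGroup 0ℓ 0ℓ
  GroupG = record
    { Carrier = List (Fin r)
    ; _≈_     = λ w w' → ∀ x → eval w x ≡ eval w' x
    ; _∙_     = _++_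
    ; ε       = []
    ; _⁻¹     = reverse
    }

  InducedGroup : (Fin n → Set) → RawGroup 0ℓ 0ℓ
  InducedGroup Q = record
    { Carrier = List (Fin r)
    ; _≈_     = λ w w' → ∀ x → Q x → eval w x ≡ eval w' x
    ; _∙_     = _++_
    ; ε       = []
    ; _⁻¹     = reverse
    }

  Edge : Fin r → Fin n → Fin n → Set
  Edge j a b = (a ≢ b) × (ρ j a ≡ b)

  Adjacent : Fin n → Fin n → Set
  Adjacent a b = ∃ λ j → Edge j a b

  Connected-to : Fin n → Fin n → Set
  Connected-to = Star Adjacent

  GraphConnected : Set
  GraphConnected = ∀ a b → Connected-to a b

  Shape : Fin r → Fin n → Fin n → (Fin n → Bool) → Set
  Shape i u v inΩ' =
    Edge i u v ×
    (∀ a b → Edge i a b → (a ≡ u × b ≡ v) ⊎ (a ≡ v × b ≡ u)) ×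
    inΩ' u ≡ true × inΩ' v ≡ false ×
    (∀ j a b → Edge j a b → j ≢ i →
        (inΩ' a ≡ true  × inΩ' b ≡ true  × toℕ j < toℕ i) ⊎
        (inΩ' a ≡ false × inΩ' b ≡ false × toℕ i < toℕ j))

-- The symmetric group S_m on Fin m (product = composition: (π ∙ σ)(x) = π(σ(x))).

Sym : ℕ → RawGroup 0ℓ 0ℓ
Sym m = record
  { Carrier = Permutation′ m
  ; _≈_     = P._≈_
  ; _∙_     = λ π σ → σ ∘ₚ π
  ; ε       = P.id
  ; _⁻¹     = flip
  }

_×G_ : RawGroup 0ℓ 0ℓ → RawGroup 0ℓ 0ℓ → RawGroup 0ℓ 0ℓ
_×G_ = DP.rawGroup

_≅_ : RawGroup 0ℓ 0ℓ → RawGroup 0ℓ 0ℓ → Set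
G₁ ≅ G₂ = ∃ λ (f : RawGroup.Carrier G₁ → RawGroup.Carrier G₂) →
  MS.GroupMorphisms.IsGroupIsomorphism G₁ G₂ f

{-# OPTIONS --safe #-}
-- As {u,v} is the only i-edge, ρᵢ is the
-- transposition (u v); generators of label < i move only points of Ω′, so
-- they fix v, and those of label > i fix u. Conjugating by generators thus
-- propagates "(a v) ∈ G for a ∈ Ω′, (u a) ∈ G for a ∈ Ω″" along edges
-- starting at u, so G contains every transposition of the component C of u.
-- Hence every permutation of C is induced by a word fixing all points
-- outside C, which makes w ↦ (w|C , w) an isomorphism G ≅ Sym(C) × H, and
-- w ↦ w|C an isomorphism G ≅ Sym(Ω) when C = Ω.
module Submission where

open import Defs
open import Data.Nat using (ℕ; _<_)
open import Data.Nat.Properties using (<-asym; <-irrefl)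
open import Data.Fin using (Fin; toℕ; zero; suc)
open import Data.Fin.Properties using (_≟_)
open import Data.Bool using (Bool; true; false)
open import Data.List using (List; []; _∷_; _++_; reverse; [_]; length; lookup)
open import Data.List.Properties using (unfold-reverse; reverse-involutive)
open import Data.List.Relation.Unary.All as All using ()
open import Data.List.Relation.Unary.AllPairs using (_∷_)
open import Data.List.Relation.Unary.Any as Any using ()
open import Data.List.Relation.Unary.Any.Properties using (lookup-index)
open import Data.List.Relation.Unary.Unique.Propositional using (Unique)
open import Data.List.Membership.Propositional using (_∈_)
open import Data.List.Membership.Propositional.Properties using (∈-lookup)
open import Data.Product using (Σ; _×_; _,_; proj₁; proj₂; <_,_>)
open import Data.Sum using (_⊎_; inj₁; inj₂)
open import Data.Empty using (⊥; ⊥-elim)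
open import Function using (id; _∘_)
open import Function.Definitions using (Injective)
open import Relation.Nullary using (¬_; yes; no)
open import Relation.Nullary.Decidable using (dec-true; dec-false; map′; toSum)
open import Relation.Unary using (Decidable)
open import Relation.Binary.PropositionalEquality
  using (_≡_; _≢_; _≗_; refl; sym; trans; cong; cong₂; subst; subst₂; module ≡-Reasoning)
open import Relation.Binary.Construct.Closure.ReflexiveTransitive using (ε; _◅_; _◅◅_)
open import Algebra.Bundles.Raw using (RawGroup)
open import Algebra.Morphism.Structures using (module GroupMorphisms)
import Algebra.Construct.DirectProduct as DP
import Algebra.Morphism.Construct.DirectProduct as DPMorphism
open import Data.Fin.Permutation as P using (Permutation′; _⟨$⟩ʳ_; _⟨$⟩ˡ_; _∘ₚ_)
open import Data.Fin.Permutation.Components using (transpose)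
import Data.Fin.Permutation.Transposition.List as TL

open GroupMorphisms using (IsGroupHomomorphism; IsGroupIsomorphism)
open ≡-Reasoning

transpose-matchˡ : ∀ {n} (a b : Fin n) → transpose a b a ≡ b
transpose-matchˡ a b rewrite dec-true (a ≟ a) refl = refl

transpose-matchʳ : ∀ {n} (a b : Fin n) → transpose a b b ≡ a
transpose-matchʳ a b with b ≟ a
... | yes b≡a = b≡a
... | no  b≢a rewrite dec-true (b ≟ b) refl = refl

transpose-fix : ∀ {n} {a b x : Fin n} → x ≢ a → x ≢ b → transpose a b x ≡ x
transpose-fix {a = a} {b} {x} x≢a x≢b
  rewrite dec-false (x ≟ a) x≢a | dec-false (x ≟ b) x≢b = refl

transpose-self : ∀ {n} (a x : Fin n) → transpose a a x ≡ x
transpose-self a x with toSum (x ≟ a)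
... | inj₁ refl = transpose-matchˡ x x
... | inj₂ x≢a  = transpose-fix x≢a x≢a

transpose-comm : ∀ {n} (a b x : Fin n) → transpose a b x ≡ transpose b a x
transpose-comm a b x with toSum (x ≟ a) | toSum (x ≟ b)
... | inj₁ refl | _         = trans (transpose-matchˡ x b) (sym (transpose-matchʳ b x))
... | inj₂ _    | inj₁ refl = trans (transpose-matchʳ a x) (sym (transpose-matchˡ x a))
... | inj₂ x≢a  | inj₂ x≢b  = trans (transpose-fix x≢a x≢b) (sym (transpose-fix x≢b x≢a))

transpose-natural : ∀ {m n} {g : Fin m → Fin n} → Injective _≡_ _≡_ g →
                    ∀ a b x → g (transpose a b x) ≡ transpose (g a) (g b) (g x)
transpose-natural {g = g} g-injective a b x with toSum (x ≟ a) | toSum (x ≟ b)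
... | inj₁ refl | _         = trans (cong g (transpose-matchˡ x b)) (sym (transpose-matchˡ (g x) (g b)))
... | inj₂ _    | inj₁ refl = trans (cong g (transpose-matchʳ a x)) (sym (transpose-matchʳ (g a) (g x)))
... | inj₂ x≢a  | inj₂ x≢b  = trans (cong g (transpose-fix x≢a x≢b))
                                  (sym (transpose-fix (x≢a ∘ g-injective) (x≢b ∘ g-injective)))

lookup-injective : ∀ {n} {xs : List (Fin n)} → Unique xs → Injective _≡_ _≡_ (lookup xs)
lookup-injective (_ ∷ _)            {zero}  {zero}  _  = refl
lookup-injective (x∉xs ∷ _)         {zero}  {suc l} eq = ⊥-elim (All.lookup x∉xs (∈-lookup l) eq)
lookup-injective (x∉xs ∷ _)         {suc k} {zero}  eq = ⊥-elim (All.lookup x∉xs (∈-lookup k) (sym eq))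
lookup-injective (_ ∷ xs-unique)    {suc k} {suc l} eq = cong suc (lookup-injective xs-unique eq)

<,>-isGroupHomomorphism :
  ∀ {a b c ℓ₁ ℓ₂ ℓ₃} {G : RawGroup a ℓ₁} {H : RawGroup b ℓ₂} {K : RawGroup c ℓ₃} {f g} →
  IsGroupHomomorphism G H f → IsGroupHomomorphism G K g →
  IsGroupHomomorphism G (DP.rawGroup H K) < f , g >
<,>-isGroupHomomorphism {G = G} {H} {K} f-homo g-homo = record
  { isMonoidHomomorphism = DPMorphism.Monoid.Pair.isMonoidHomomorphism
      (RawGroup.rawMonoid H) (RawGroup.rawMonoid K) (RawGroup.rawMonoid G)
      F.isMonoidHomomorphism G′.isMonoidHomomorphism
  ; ⁻¹-homo = λ x → F.⁻¹-homo x , G′.⁻¹-homo x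
  }
  where
  module F = IsGroupHomomorphism f-homo
  module G′ = IsGroupHomomorphism g-homo

module _ {n r : ℕ} (ρ : Fin r → Fin n → Fin n) where

  eval-++ : ∀ w w′ x → eval ρ (w ++ w′) x ≡ eval ρ w (eval ρ w′ x)
  eval-++ []      w′ x = refl
  eval-++ (j ∷ w) w′ x = cong (ρ j) (eval-++ w w′ x)

  fixed-or-edge : ∀ j x → ρ j x ≡ x ⊎ Edge ρ j x (ρ j x)
  fixed-or-edge j x with ρ j x ≟ x
  ... | yes fixed = inj₁ fixed
  ... | no  moved = inj₂ (moved ∘ sym , refl)

  connected-ρ : ∀ {a} j {x} → Connected-to ρ a x → Connected-to ρ a (ρ j x)
  connected-ρ {a} j {x} a~x with fixed-or-edge j x
  ... | inj₁ fixed = subst (Connected-to ρ a) (sym fixed) a~x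
  ... | inj₂ edge  = a~x ◅◅ ((j , edge) ◅ ε)

  InG : (Fin n → Fin n) → Set
  InG f = Σ (List (Fin r)) λ w → eval ρ w ≗ f

  TranspositionInG : Fin n → Fin n → Set
  TranspositionInG a b = InG (transpose a b)

  InG-ρ : ∀ j → InG (ρ j)
  InG-ρ j = [ j ] , λ _ → refl

  InG-id : InG id
  InG-id = [] , λ _ → refl

  InG-resp-≗ : ∀ {f g} → f ≗ g → InG f → InG g
  InG-resp-≗ f≗g (w , w≗f) = w , λ x → trans (w≗f x) (f≗g x)

  transpositionInG-self : ∀ a → TranspositionInG a a
  transpositionInG-self a = InG-resp-≗ (sym ∘ transpose-self a) InG-id

  induced-isGroupHomomorphism : ∀ Q → IsGroupHomomorphism (GroupG ρ) (InducedGroup ρ Q) id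
  induced-isGroupHomomorphism Q = record
    { isMonoidHomomorphism = record
      { isMagmaHomomorphism = record
        { isRelHomomorphism = record { cong = λ w≈w′ x _ → w≈w′ x }
        ; homo              = λ _ _ _ _ → refl
        }
      ; ε-homo = λ _ _ → refl
      }
    ; ⁻¹-homo = λ _ _ _ → refl
    }

  module _ (ρ-involutive : ∀ j x → ρ j (ρ j x) ≡ x) where

    eval-reverse-inverseˡ : ∀ w x → eval ρ (reverse w) (eval ρ w x) ≡ x
    eval-reverse-inverseˡ []      x = refl
    eval-reverse-inverseˡ (j ∷ w) x = begin
      eval ρ (reverse (j ∷ w)) (ρ j y)  ≡⟨ cong (λ w′ → eval ρ w′ (ρ j y)) (unfold-reverse j w) ⟩
      eval ρ (reverse w ++ [ j ]) (ρ j y) ≡⟨ eval-++ (reverse w) [ j ] (ρ j y) ⟩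
      eval ρ (reverse w) (ρ j (ρ j y))    ≡⟨ cong (eval ρ (reverse w)) (ρ-involutive j y) ⟩
      eval ρ (reverse w) y                ≡⟨ eval-reverse-inverseˡ w x ⟩
      x                                   ∎
      where y = eval ρ w x

    eval-reverse-inverseʳ : ∀ w x → eval ρ w (eval ρ (reverse w) x) ≡ x
    eval-reverse-inverseʳ w x =
      subst (λ w′ → eval ρ w′ (eval ρ (reverse w) x) ≡ x)
            (reverse-involutive w) (eval-reverse-inverseˡ (reverse w) x)

    eval-injective : ∀ w → Injective _≡_ _≡_ (eval ρ w)
    eval-injective w {x} {y} eq = begin
      x                                   ≡⟨ sym (eval-reverse-inverseˡ w x) ⟩
      eval ρ (reverse w) (eval ρ w x)     ≡⟨ cong (eval ρ (reverse w)) eq ⟩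
      eval ρ (reverse w) (eval ρ w y)     ≡⟨ eval-reverse-inverseˡ w y ⟩
      y                                   ∎

    transpositionInG-conj : ∀ {σ a b} → InG σ → TranspositionInG a b →
                            TranspositionInG (σ a) (σ b)
    transpositionInG-conj {σ} {a} {b} (s , s≗σ) (t , t≗ab) = s ++ t ++ reverse s , λ x → begin
      eval ρ (s ++ t ++ reverse s) x     ≡⟨ eval-++ s (t ++ reverse s) x ⟩
      ŝ (eval ρ (t ++ reverse s) x)      ≡⟨ cong ŝ (eval-++ t (reverse s) x) ⟩
      ŝ (eval ρ t (ŝ⁻¹ x))               ≡⟨ cong ŝ (t≗ab (ŝ⁻¹ x)) ⟩
      ŝ (transpose a b (ŝ⁻¹ x))          ≡⟨ transpose-natural (eval-injective s) a b (ŝ⁻¹ x) ⟩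
      transpose (ŝ a) (ŝ b) (ŝ (ŝ⁻¹ x))  ≡⟨ cong₂ (λ p q → transpose p q (ŝ (ŝ⁻¹ x))) (s≗σ a) (s≗σ b) ⟩
      transpose (σ a) (σ b) (ŝ (ŝ⁻¹ x))  ≡⟨ cong (transpose (σ a) (σ b)) (eval-reverse-inverseʳ s x) ⟩
      transpose (σ a) (σ b) x            ∎
      where
      ŝ ŝ⁻¹ : Fin n → Fin n
      ŝ   = eval ρ s
      ŝ⁻¹ = eval ρ (reverse s)

-- Identifies Sym(S) with Sym m, so that restricting words to S lands in Sym m.
record Enumeration {n : ℕ} (S : Fin n → Set) (m : ℕ) : Set where
  field
    point           : Fin m → Fin n
    point-injective : Injective _≡_ _≡_ point
    point∈S         : ∀ k → S (point k)
    index           : ∀ {x} → S x → Fin m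
    point-index     : ∀ {x} (x∈S : S x) → point (index x∈S) ≡ x

id-enumeration : ∀ {n} {S : Fin n → Set} → (∀ x → S x) → Enumeration S n
id-enumeration S-full = record
  { point           = id
  ; point-injective = id
  ; point∈S         = S-full
  ; index           = λ {x} _ → x
  ; point-index     = λ _ → refl
  }

lookup-enumeration : ∀ {n} {S : Fin n → Set} {xs : List (Fin n)} → Unique xs →
                     (∀ x → S x → x ∈ xs) → (∀ x → x ∈ xs → S x) →
                     Enumeration S (length xs)
lookup-enumeration {xs = xs} xs-unique S⊆xs xs⊆S = record
  { point           = lookup xs
  ; point-injective = lookup-injective xs-unique
  ; point∈S         = λ k → xs⊆S _ (∈-lookup k)
  ; index           = λ {x} x∈S → Any.index (S⊆xs x x∈S)
  ; point-index     = λ {x} x∈S → sym (lookup-index (S⊆xs x x∈S))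
  }

module Restriction {n r m : ℕ} (ρ : Fin r → Fin n → Fin n)
  (ρ-involutive : ∀ j x → ρ j (ρ j x) ≡ x)
  {S : Fin n → Set} (S-closed : ∀ j {x} → S x → S (ρ j x))
  (enumeration : Enumeration S m) where

  open Enumeration enumeration

  S-closed-eval : ∀ w {x} → S x → S (eval ρ w x)
  S-closed-eval []      x∈S = x∈S
  S-closed-eval (j ∷ w) x∈S = S-closed j (S-closed-eval w x∈S)

  act : List (Fin r) → Fin m → Fin m
  act w k = index (S-closed-eval w (point∈S k))

  point-act : ∀ w k → point (act w k) ≡ eval ρ w (point k)
  point-act w k = point-index _

  restrict : List (Fin r) → Permutation′ m
  restrict w = P.permutation (act w) (act (reverse w))
    (λ k → point-injective (begin
      point (act w (act (reverse w) k))             ≡⟨ point-act w _ ⟩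
      eval ρ w (point (act (reverse w) k))          ≡⟨ cong (eval ρ w) (point-act (reverse w) k) ⟩
      eval ρ w (eval ρ (reverse w) (point k))       ≡⟨ eval-reverse-inverseʳ ρ ρ-involutive w (point k) ⟩
      point k                                       ∎))
    (λ k → point-injective (begin
      point (act (reverse w) (act w k))             ≡⟨ point-act (reverse w) _ ⟩
      eval ρ (reverse w) (point (act w k))          ≡⟨ cong (eval ρ (reverse w)) (point-act w k) ⟩
      eval ρ (reverse w) (eval ρ w (point k))       ≡⟨ eval-reverse-inverseˡ ρ ρ-involutive w (point k) ⟩
      point k                                       ∎))

  restrict-≈ : ∀ w π → (∀ k → eval ρ w (point k) ≡ point (π ⟨$⟩ʳ k)) → restrict w P.≈ π
  restrict-≈ w π w≗π k = point-injective (trans (point-act w k) (w≗π k))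

  restrict-cong : ∀ w w′ → (∀ x → eval ρ w x ≡ eval ρ w′ x) → restrict w P.≈ restrict w′
  restrict-cong w w′ w≈w′ = restrict-≈ w (restrict w′) λ k →
    trans (w≈w′ (point k)) (sym (point-act w′ k))

  restrict-isGroupHomomorphism : IsGroupHomomorphism (GroupG ρ) (Sym m) restrict
  restrict-isGroupHomomorphism = record
    { isMonoidHomomorphism = record
      { isMagmaHomomorphism = record
        { isRelHomomorphism = record
          { cong = λ {w} {w′} → restrict-cong w w′ }
        ; homo = λ w w′ → restrict-≈ (w ++ w′) (restrict w′ ∘ₚ restrict w) λ k → begin
            eval ρ (w ++ w′) (point k)            ≡⟨ eval-++ ρ w w′ (point k) ⟩
            eval ρ w (eval ρ w′ (point k))        ≡⟨ cong (eval ρ w) (sym (point-act w′ k)) ⟩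
            eval ρ w (point (act w′ k))           ≡⟨ sym (point-act w (act w′ k)) ⟩
            point (act w (act w′ k))              ∎
        }
      ; ε-homo = restrict-≈ [] P.id λ _ → refl
      }
    ; ⁻¹-homo = λ _ _ → refl
    }

  restrict-≈⇒agree-on-S : ∀ w w′ → restrict w P.≈ restrict w′ →
                          ∀ {x} → S x → eval ρ w x ≡ eval ρ w′ x
  restrict-≈⇒agree-on-S w w′ w≈w′ {x} x∈S = begin
    eval ρ w x                        ≡⟨ cong (eval ρ w) (sym (point-index x∈S)) ⟩
    eval ρ w (point k)                ≡⟨ sym (point-act w k) ⟩
    point (act w k)                   ≡⟨ cong point (w≈w′ k) ⟩
    point (act w′ k)                  ≡⟨ point-act w′ k ⟩
    eval ρ w′ (point k)               ≡⟨ cong (eval ρ w′) (point-index x∈S) ⟩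
    eval ρ w′ x                       ∎
    where k = index x∈S

  agree-everywhere : Decidable S → ∀ w w′ → restrict w P.≈ restrict w′ →
                     (∀ x → ¬ S x → eval ρ w x ≡ eval ρ w′ x) → eval ρ w ≗ eval ρ w′
  agree-everywhere S? w w′ on-S off-S x with S? x
  ... | yes x∈S = restrict-≈⇒agree-on-S w w′ on-S x∈S
  ... | no  x∉S = off-S x x∉S

  FixesOutside : List (Fin r) → Set
  FixesOutside w = ∀ x → ¬ S x → eval ρ w x ≡ x

  module _ (transpositions : ∀ {a b} → S a → S b → TranspositionInG ρ a b) where

    lift-transpositions : ∀ ts → Σ (List (Fin r)) λ w → restrict w P.≈ TL.eval ts × FixesOutside w
    lift-transpositions []             = [] , restrict-≈ [] P.id (λ _ → refl) , λ _ _ → refl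
    lift-transpositions ((a , b) ∷ ts) with lift-transpositions ts | transpositions (point∈S a) (point∈S b)
    ... | w , w≈ts , w-fixes | t , t≗ab = w ++ t , restrict-≈ (w ++ t) (TL.eval ((a , b) ∷ ts)) on-S , off-S
      where
      on-S : ∀ k → eval ρ (w ++ t) (point k) ≡ point (TL.eval ts ⟨$⟩ʳ transpose a b k)
      on-S k = begin
        eval ρ (w ++ t) (point k)                               ≡⟨ eval-++ ρ w t (point k) ⟩
        eval ρ w (eval ρ t (point k))                           ≡⟨ cong (eval ρ w) (t≗ab (point k)) ⟩
        eval ρ w (transpose (point a) (point b) (point k))
          ≡⟨ cong (eval ρ w) (sym (transpose-natural point-injective a b k)) ⟩
        eval ρ w (point (transpose a b k))                      ≡⟨ sym (point-act w _) ⟩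
        point (restrict w ⟨$⟩ʳ transpose a b k)                 ≡⟨ cong point (w≈ts _) ⟩
        point (TL.eval ts ⟨$⟩ʳ transpose a b k)                 ∎

      off-S : FixesOutside (w ++ t)
      off-S x x∉S = begin
        eval ρ (w ++ t) x                           ≡⟨ eval-++ ρ w t x ⟩
        eval ρ w (eval ρ t x)                       ≡⟨ cong (eval ρ w) (t≗ab x) ⟩
        eval ρ w (transpose (point a) (point b) x)
          ≡⟨ cong (eval ρ w) (transpose-fix (x≢point a) (x≢point b)) ⟩
        eval ρ w x                                  ≡⟨ w-fixes x x∉S ⟩
        x                                           ∎
        where
        x≢point : ∀ k → x ≢ point k
        x≢point k refl = x∉S (point∈S k)

    lift : ∀ π → Σ (List (Fin r)) λ w → restrict w P.≈ π × FixesOutside w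
    lift π with lift-transpositions (TL.decompose π)
    ... | w , w≈ , w-fixes = w , (λ k → trans (w≈ k) (TL.eval-decompose π k)) , w-fixes

    lift-agreeing-outside : ∀ π h → Σ (List (Fin r)) λ w →
      restrict w P.≈ π × (∀ x → ¬ S x → eval ρ w x ≡ eval ρ h x)
    lift-agreeing-outside π h with lift (π ∘ₚ P.flip (restrict h))
    ... | w , w≈π∘h⁻¹ , w-fixes = h ++ w , restrict-≈ (h ++ w) π on-S , off-S
      where
      on-S : ∀ k → eval ρ (h ++ w) (point k) ≡ point (π ⟨$⟩ʳ k)
      on-S k = begin
        eval ρ (h ++ w) (point k)                            ≡⟨ eval-++ ρ h w (point k) ⟩
        eval ρ h (eval ρ w (point k))                        ≡⟨ cong (eval ρ h) (sym (point-act w k)) ⟩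
        eval ρ h (point (restrict w ⟨$⟩ʳ k))                 ≡⟨ cong (eval ρ h ∘ point) (w≈π∘h⁻¹ k) ⟩
        eval ρ h (point (restrict h ⟨$⟩ˡ (π ⟨$⟩ʳ k)))        ≡⟨ sym (point-act h _) ⟩
        point (restrict h ⟨$⟩ʳ (restrict h ⟨$⟩ˡ (π ⟨$⟩ʳ k))) ≡⟨ cong point (P.inverseʳ (restrict h)) ⟩
        point (π ⟨$⟩ʳ k)                                     ∎

      off-S : ∀ x → ¬ S x → eval ρ (h ++ w) x ≡ eval ρ h x
      off-S x x∉S = trans (eval-++ ρ h w x) (cong (eval ρ h) (w-fixes x x∉S))

    restrict-isGroupIsomorphism : (∀ x → S x) → IsGroupIsomorphism (GroupG ρ) (Sym m) restrict
    restrict-isGroupIsomorphism S-full = record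
      { isGroupMonomorphism = record
        { isGroupHomomorphism = restrict-isGroupHomomorphism
        ; injective           = λ {w} {w′} w≈w′ x → restrict-≈⇒agree-on-S w w′ w≈w′ (S-full x)
        }
      ; surjective          = λ π → let w , w≈π , _ = lift π in
          w , λ {w′} w′≈w k → trans (restrict-cong w′ w w′≈w k) (w≈π k)
      }

    restrict×id-isGroupIsomorphism : Decidable S →
      IsGroupIsomorphism (GroupG ρ) (Sym m ×G InducedGroup ρ (λ x → ¬ S x)) < restrict , id >
    restrict×id-isGroupIsomorphism S? = record
      { isGroupMonomorphism = record
        { isGroupHomomorphism = <,>-isGroupHomomorphism restrict-isGroupHomomorphism
                                                        (induced-isGroupHomomorphism ρ _)
        ; injective           = λ {w} {w′} (on-S , off-S) → agree-everywhere S? w w′ on-S off-S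
        }
      ; surjective          = λ (π , h) → let w , w≈π , w≈h = lift-agreeing-outside π h in
          w , λ {w′} w′≈w → (λ k → trans (restrict-cong w′ w w′≈w k) (w≈π k))
                          , (λ x x∉S → trans (w′≈w x) (w≈h x x∉S))
      }

module ShapeArgument {n r : ℕ} (ρ : Fin r → Fin n → Fin n)
  (ρ-involutive : ∀ j x → ρ j (ρ j x) ≡ x)
  {i : Fin r} {u v : Fin n} {inΩ′ : Fin n → Bool}
  (uv-edge : Edge ρ i u v)
  (only-uv-edge : ∀ a b → Edge ρ i a b → (a ≡ u × b ≡ v) ⊎ (a ≡ v × b ≡ u))
  (u∈Ω′ : inΩ′ u ≡ true) (v∉Ω′ : inΩ′ v ≡ false)
  (other-edge : ∀ j a b → Edge ρ j a b → j ≢ i →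
     (inΩ′ a ≡ true  × inΩ′ b ≡ true  × toℕ j < toℕ i) ⊎
     (inΩ′ a ≡ false × inΩ′ b ≡ false × toℕ i < toℕ j)) where

  Ω′-Ω″-disjoint : ∀ {a} → inΩ′ a ≡ true → inΩ′ a ≡ false → ⊥
  Ω′-Ω″-disjoint a∈Ω′ a∉Ω′ with trans (sym a∈Ω′) a∉Ω′
  ... | ()

  ρi≗transpose : ρ i ≗ transpose u v
  ρi≗transpose x with toSum (x ≟ u) | toSum (x ≟ v)
  ... | inj₁ refl | _         = trans (proj₂ uv-edge) (sym (transpose-matchˡ x v))
  ... | inj₂ _    | inj₁ refl = begin
    ρ i x            ≡⟨ cong (ρ i) (sym (proj₂ uv-edge)) ⟩
    ρ i (ρ i u)      ≡⟨ ρ-involutive i u ⟩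
    u                ≡⟨ sym (transpose-matchʳ u x) ⟩
    transpose u x x  ∎
  ... | inj₂ x≢u  | inj₂ x≢v with fixed-or-edge ρ i x
  ...   | inj₁ fixed = trans fixed (sym (transpose-fix x≢u x≢v))
  ...   | inj₂ edge with only-uv-edge x (ρ i x) edge
  ...     | inj₁ (x≡u , _) = ⊥-elim (x≢u x≡u)
  ...     | inj₂ (x≡v , _) = ⊥-elim (x≢v x≡v)

  uv∈G : TranspositionInG ρ u v
  uv∈G = [ i ] , ρi≗transpose

  below-fixes-v : ∀ {j} → toℕ j < toℕ i → ρ j v ≡ v
  below-fixes-v {j} j<i with fixed-or-edge ρ j v
  ... | inj₁ fixed = fixed
  ... | inj₂ edge with other-edge j v (ρ j v) edge (λ j≡i → <-irrefl (cong toℕ j≡i) j<i)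
  ...   | inj₁ (v∈Ω′ , _)   = ⊥-elim (Ω′-Ω″-disjoint v∈Ω′ v∉Ω′)
  ...   | inj₂ (_ , _ , i<j) = ⊥-elim (<-asym j<i i<j)

  above-fixes-u : ∀ {j} → toℕ i < toℕ j → ρ j u ≡ u
  above-fixes-u {j} i<j with fixed-or-edge ρ j u
  ... | inj₁ fixed = fixed
  ... | inj₂ edge with other-edge j u (ρ j u) edge (λ j≡i → <-irrefl (cong toℕ (sym j≡i)) i<j)
  ...   | inj₁ (_ , _ , j<i) = ⊥-elim (<-asym j<i i<j)
  ...   | inj₂ (u∉Ω′ , _)   = ⊥-elim (Ω′-Ω″-disjoint u∈Ω′ u∉Ω′)

  Across : Fin n → Set
  Across a = (inΩ′ a ≡ true × TranspositionInG ρ a v) ⊎ (inΩ′ a ≡ false × TranspositionInG ρ u a)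

  across-step : ∀ {a b} → Across a → Adjacent ρ a b → Across b
  across-step {a} {b} a-across (j , edge) with j ≟ i
  ... | yes refl with only-uv-edge a b edge
  ...   | inj₁ (refl , refl) = inj₂ (v∉Ω′ , uv∈G)
  ...   | inj₂ (refl , refl) = inj₁ (u∈Ω′ , uv∈G)
  across-step {a} {b} a-across (j , edge@(_ , ρja≡b)) | no j≢i with other-edge j a b edge j≢i | a-across
  ...   | inj₁ (_ , b∈Ω′ , j<i) | inj₁ (_ , av∈G) =
    inj₁ (b∈Ω′ , subst₂ (TranspositionInG ρ) ρja≡b (below-fixes-v j<i)
                        (transpositionInG-conj ρ ρ-involutive (InG-ρ ρ j) av∈G))
  ...   | inj₂ (_ , b∉Ω′ , i<j) | inj₂ (_ , ua∈G) =
    inj₂ (b∉Ω′ , subst₂ (TranspositionInG ρ) (above-fixes-u i<j) ρja≡b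
                        (transpositionInG-conj ρ ρ-involutive (InG-ρ ρ j) ua∈G))
  ...   | inj₁ (a∈Ω′ , _)       | inj₂ (a∉Ω′ , _) = ⊥-elim (Ω′-Ω″-disjoint a∈Ω′ a∉Ω′)
  ...   | inj₂ (a∉Ω′ , _)       | inj₁ (a∈Ω′ , _) = ⊥-elim (Ω′-Ω″-disjoint a∈Ω′ a∉Ω′)

  across-path : ∀ {a b} → Across a → Connected-to ρ a b → Across b
  across-path a-across ε             = a-across
  across-path a-across (edge ◅ path) = across-path (across-step a-across edge) path

  transposition-to-v : ∀ {a} → Connected-to ρ u a → TranspositionInG ρ a v
  transposition-to-v {a} u~a with across-path (inj₁ (u∈Ω′ , uv∈G)) u~a | toSum (a ≟ v)
  ... | inj₁ (_ , av∈G)     | _         = av∈G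
  ... | inj₂ _              | inj₁ refl = transpositionInG-self ρ a
  ... | inj₂ (a∉Ω′ , ua∈G) | inj₂ a≢v  =
    InG-resp-≗ ρ (transpose-comm v a)
      (subst₂ (TranspositionInG ρ) (transpose-matchˡ u v) (transpose-fix a≢u a≢v)
              (transpositionInG-conj ρ ρ-involutive uv∈G ua∈G))
    where
    a≢u : a ≢ u
    a≢u refl = Ω′-Ω″-disjoint u∈Ω′ a∉Ω′

  transposition-in-component : ∀ {a b} → Connected-to ρ u a → Connected-to ρ u b →
                               TranspositionInG ρ a b
  transposition-in-component {a} {b} u~a u~b with toSum (b ≟ v) | toSum (b ≟ a)
  ... | inj₁ refl | _         = transposition-to-v u~a
  ... | inj₂ _    | inj₁ refl = transpositionInG-self ρ b
  ... | inj₂ b≢v  | inj₂ b≢a  =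
    InG-resp-≗ ρ (transpose-comm b a)
      (subst₂ (TranspositionInG ρ) (transpose-fix b≢a b≢v) (transpose-matchʳ a v)
              (transpositionInG-conj ρ ρ-involutive (transposition-to-v u~a) (transposition-to-v u~b)))

lemma3p1 : ∀ {n r : ℕ} (ρ : Fin r → Fin n → Fin n) → IsSggi ρ →
    ∀ (i : Fin r) (u v : Fin n) (inΩ' : Fin n → Bool) → Shape ρ i u v inΩ' →
    (GraphConnected ρ → GroupG ρ ≅ Sym n) ×
    (¬ GraphConnected ρ →
      ∀ (C : List (Fin n)) → Unique C →
        (∀ x → Connected-to ρ u x → x ∈ C) → (∀ x → x ∈ C → Connected-to ρ u x) →
        GroupG ρ ≅ (Sym (length C) ×G InducedGroup ρ (λ x → ¬ Connected-to ρ u x)))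
lemma3p1 {n} ρ (involutions , _) i u v inΩ′ (uv-edge , only-uv-edge , u∈Ω′ , v∉Ω′ , other-edge) =
  connected-case , λ _ → disconnected-case
  where
  ρ-involutive : ∀ j x → ρ j (ρ j x) ≡ x
  ρ-involutive j = proj₁ (involutions j)

  component-transpositions : ∀ {a b} → Connected-to ρ u a → Connected-to ρ u b →
                             TranspositionInG ρ a b
  component-transpositions = ShapeArgument.transposition-in-component
    ρ ρ-involutive uv-edge only-uv-edge u∈Ω′ v∉Ω′ other-edge

  connected-case : GraphConnected ρ → GroupG ρ ≅ Sym n
  connected-case connected =
    restrict , restrict-isGroupIsomorphism component-transpositions (connected u)
    where open Restriction ρ ρ-involutive (connected-ρ ρ {u}) (id-enumeration (connected u))

  disconnected-case : ∀ C → Unique C →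
    (∀ x → Connected-to ρ u x → x ∈ C) → (∀ x → x ∈ C → Connected-to ρ u x) →
    GroupG ρ ≅ (Sym (length C) ×G InducedGroup ρ (λ x → ¬ Connected-to ρ u x))
  disconnected-case C C-unique component⊆C C⊆component =
    < restrict , id > , restrict×id-isGroupIsomorphism component-transpositions in-component?
    where
    open Restriction ρ ρ-involutive (connected-ρ ρ {u})
                     (lookup-enumeration C-unique component⊆C C⊆component)
    open import Data.List.Membership.DecPropositional (_≟_ {n}) using (_∈?_)

    in-component? : Decidable (Connected-to ρ u)
    in-component? x = map′ (C⊆component x) (component⊆C x) (x ∈? C)
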